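{- Let $C$ be a clusteron occupying at least two rooms. No state reachable from $C$ contains a room that holds more than one violinist and whose two neighboring rooms are both unoccupied.
   Context: Rooms are indexed by the integers, room $i$ adjacent to rooms $i\pm1$. A state is a function $a:\mathbb{Z}\to\mathbb{Z}_{\ge0}$ with finite support ($a_i$ = number of indistinguishable violinists in room $i$; several may share a room). Room $i$ is occupied if $a_i\ge1$. A move is possible whenever two adjacent rooms $i,i+1$ are both occupied: one violinist leaves room $i$ for the nearest unoccupied room to the left of $i$, and one violinist leaves room $i+1$ for the nearest unoccupied room to the right of $i+1$. Reachable means obtained by a finite (possibly empty) sequence of moves. A clusteron is a state whose occupied rooms form a nonempty set of consecutive rooms. -}

module Defs where

open import Data.Nat using (ℕ; zero; suc; _∸_)
open import Data.Integer using (ℤ; _+_; _-_; _<_; _≤_; 1ℤ)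
open import Data.Integer.Properties using (_≟_)
open import Data.Bool using (if_then_else_)
open import Data.Product using (_×_; ∃; ∃-syntax; Σ-syntax)
open import Data.Sum using (_⊎_)
open import Relation.Nullary using (¬_; does)
open import Relation.Binary.PropositionalEquality using (_≡_)
open import Relation.Binary.Construct.Closure.ReflexiveTransitive using (Star)

-- A configuration: a i = number of violinists in room i.
Config : Set
Config = ℤ → ℕ

-- "State": finite support.
FiniteSupport : Config → Set
FiniteSupport a = ∃[ lo ] ∃[ hi ] (∀ m → (m < lo ⊎ hi < m) → a m ≡ 0)

Occupied : Config → ℤ → Set
Occupied a m = ¬ (a m ≡ 0)

upd : Config → ℤ → (ℕ → ℕ) → Config
upd a x f m = if does (m ≟ x) then f (a m) else a m

-- Result of a move at the pair (i, i+1), with j the nearest unoccupied room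
-- left of i and k the nearest unoccupied room right of i+1.
moveResult : Config → ℤ → ℤ → ℤ → Config
moveResult a i j k =
  upd (upd (upd (upd a i (λ n → n ∸ 1)) (i + 1ℤ) (λ n → n ∸ 1)) j suc) k suc

data Move (a : Config) : Config → Set where
  move : (i j k : ℤ) →
         Occupied a i → Occupied a (i + 1ℤ) →
         j < i → a j ≡ 0 → (∀ m → j < m → m ≤ i → Occupied a m) →
         i + 1ℤ < k → a k ≡ 0 → (∀ m → i + 1ℤ ≤ m → m < k → Occupied a m) →
         Move a (moveResult a i j k)

Reachable : Config → Config → Set
Reachable = Star Move

IsClusteron : Config → Set
IsClusteron a = ∃[ l ] ∃[ r ] (l ≤ r × (∀ m → (Occupied a m → l ≤ m × m ≤ r) × (l ≤ m × m ≤ r → Occupied a m)))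

AtLeastTwoOccupied : Config → Set
AtLeastTwoOccupied a = ∃[ p ] ∃[ q ] (¬ (p ≡ q) × Occupied a p × Occupied a q)

module Submission where

open import Defs
open import Data.Nat using (_≥_)
open import Data.Integer using (_+_; _-_; 1ℤ)
open import Data.Product using (_×_)
open import Relation.Nullary using (¬_)
open import Relation.Binary.PropositionalEquality using (_≡_)

-- A stack isolated by two empty neighbours never appears: a clusteron with at least two rooms has
-- none, since each of its rooms has an occupied neighbour, and moves preserve this. A move at
-- (i, i+1) with landing rooms j < i and k > i+1 leaves the block [j, k] occupied except possibly
-- at i and i+1. Inside the block, a room in (j, i] has its left neighbour in [j, i) and a room in
-- (i, k) its right neighbour in (i+1, k]; the ends j and k hold one violinist each; and outside the
-- block no room gains a violinist nor has a neighbour that loses one, so an isolated stack there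
-- was already isolated before the move.

open import Data.Bool using (if_then_else_)
open import Data.Empty using (⊥-elim)
open import Data.Nat as ℕ using (suc; _∸_)
import Data.Nat.Properties as ℕ
open import Data.Integer using (ℤ; -1ℤ; _<_; _≤_)
open import Data.Integer.Properties
  using (_≟_; _≤?_; ≰⇒>; <-cmp; <-trans; <-≤-trans; ≤-<-trans; <⇒≤; <⇒≢; ≤∧≢⇒<; ≤-antisym; ≤-reflexive;
         +-comm; +-monoˡ-<; i<j⇒suc[i]≤j; suc[i]≤j⇒i<j; i<j⇒i≤pred[j]; i≤pred[j]⇒i<j)
open import Data.Product using (_,_; proj₁; proj₂)
open import Data.Sum using (_⊎_; inj₁; inj₂)
open import Function using (_∘_; id)
open import Relation.Binary.Definitions using (tri<; tri≈; tri>)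
open import Relation.Binary.PropositionalEquality using (_≢_; refl; sym; trans; cong; subst; module ≡-Reasoning)
open import Relation.Binary.Construct.Closure.ReflexiveTransitive using (ε; _◅_)
open import Relation.Nullary using (Dec; yes; no)
open import Relation.Nullary.Decidable using (dec-true; dec-false)

i<j⇒i+1≤j : ∀ {i j} → i < j → i + 1ℤ ≤ j
i<j⇒i+1≤j {i} {j} i<j = subst (_≤ j) (+-comm 1ℤ i) (i<j⇒suc[i]≤j i<j)

i<j⇒i≤j-1 : ∀ {i j} → i < j → i ≤ j - 1ℤ
i<j⇒i≤j-1 {i} {j} i<j = subst (i ≤_) (+-comm -1ℤ j) (i<j⇒i≤pred[j] i<j)

i<i+1 : ∀ i → i < i + 1ℤ
i<i+1 i = suc[i]≤j⇒i<j (≤-reflexive (+-comm 1ℤ i))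

i-1<i : ∀ i → i - 1ℤ < i
i-1<i i = i≤pred[j]⇒i<j (≤-reflexive (+-comm i -1ℤ))

>⇒≢ : ∀ {i j} → j < i → i ≢ j
>⇒≢ j<i = <⇒≢ j<i ∘ sym

upd-self : ∀ a x f → upd a x f x ≡ f (a x)
upd-self a x f = cong (λ c → if c then f (a x) else a x) (dec-true (x ≟ x) refl)

upd-other : ∀ a x f {m} → m ≢ x → upd a x f m ≡ a m
upd-other a x f {m} m≢x = cong (λ c → if c then f (a m) else a m) (dec-false (m ≟ x) m≢x)

upd-inflationary : ∀ {f} → (∀ n → n ℕ.≤ f n) → ∀ a x m → a m ℕ.≤ upd a x f m
upd-inflationary f-infl a x m with m ≟ x
... | yes _ = f-infl (a m)
... | no _  = ℕ.≤-refl

upd-deflationary : ∀ {f} → (∀ n → f n ℕ.≤ n) → ∀ a x m → upd a x f m ℕ.≤ a m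
upd-deflationary f-defl a x m with m ≟ x
... | yes _ = f-defl (a m)
... | no _  = ℕ.≤-refl

module _ (a : Config) (i j k : ℤ) where

  private
    departed₁ departed₂ arrived₁ : Config
    departed₁ = upd a i (_∸ 1)
    departed₂ = upd departed₁ (i + 1ℤ) (_∸ 1)
    arrived₁  = upd departed₂ j suc

  moveResult-≥ : ∀ {x} → x ≢ i → x ≢ i + 1ℤ → a x ℕ.≤ moveResult a i j k x
  moveResult-≥ {x} x≢i x≢i+1 = begin
    a x                  ≡⟨ upd-other a i (_∸ 1) x≢i ⟨
    departed₁ x          ≡⟨ upd-other departed₁ (i + 1ℤ) (_∸ 1) x≢i+1 ⟨
    departed₂ x          ≤⟨ upd-inflationary ℕ.n≤1+n departed₂ j x ⟩
    arrived₁ x           ≤⟨ upd-inflationary ℕ.n≤1+n arrived₁ k x ⟩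
    moveResult a i j k x ∎
    where open ℕ.≤-Reasoning

  moveResult-≤ : ∀ {x} → x ≢ j → x ≢ k → moveResult a i j k x ℕ.≤ a x
  moveResult-≤ {x} x≢j x≢k = begin
    moveResult a i j k x ≡⟨ upd-other arrived₁ k suc x≢k ⟩
    arrived₁ x           ≡⟨ upd-other departed₂ j suc x≢j ⟩
    departed₂ x          ≤⟨ upd-deflationary (λ n → ℕ.m∸n≤m n 1) departed₁ (i + 1ℤ) x ⟩
    departed₁ x          ≤⟨ upd-deflationary (λ n → ℕ.m∸n≤m n 1) a i x ⟩
    a x                  ∎
    where open ℕ.≤-Reasoning

  moveResult-left : j ≢ i → j ≢ i + 1ℤ → j ≢ k → moveResult a i j k j ≡ suc (a j)
  moveResult-left j≢i j≢i+1 j≢k = begin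
    moveResult a i j k j ≡⟨ upd-other arrived₁ k suc j≢k ⟩
    arrived₁ j           ≡⟨ upd-self departed₂ j suc ⟩
    suc (departed₂ j)     ≡⟨ cong suc (upd-other departed₁ (i + 1ℤ) (_∸ 1) j≢i+1) ⟩
    suc (departed₁ j)      ≡⟨ cong suc (upd-other a i (_∸ 1) j≢i) ⟩
    suc (a j)            ∎
    where open ≡-Reasoning

  moveResult-right : k ≢ i → k ≢ i + 1ℤ → k ≢ j → moveResult a i j k k ≡ suc (a k)
  moveResult-right k≢i k≢i+1 k≢j = begin
    moveResult a i j k k ≡⟨ upd-self arrived₁ k suc ⟩
    suc (arrived₁ k)     ≡⟨ cong suc (upd-other departed₂ j suc k≢j) ⟩
    suc (departed₂ k)     ≡⟨ cong suc (upd-other departed₁ (i + 1ℤ) (_∸ 1) k≢i+1) ⟩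
    suc (departed₁ k)      ≡⟨ cong suc (upd-other a i (_∸ 1) k≢i) ⟩
    suc (a k)            ∎
    where open ≡-Reasoning

m≤n∧n≡0⇒m≡0 : ∀ {m n} → m ℕ.≤ n → n ≡ 0 → m ≡ 0
m≤n∧n≡0⇒m≡0 {m} m≤n n≡0 = ℕ.n≤0⇒n≡0 (subst (m ℕ.≤_) n≡0 m≤n)

IsolatedStack : Config → ℤ → Set
IsolatedStack a m = a m ≥ 2 × a (m - 1ℤ) ≡ 0 × a (m + 1ℤ) ≡ 0

NoIsolatedStack : Config → Set
NoIsolatedStack a = ∀ m → ¬ IsolatedStack a m

single-¬isolatedStack : ∀ {a m} → a m ≡ 1 → ¬ IsolatedStack a m
single-¬isolatedStack am≡1 (am≥2 , _) = ℕ.>⇒≢ am≥2 am≡1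

neighbour-¬isolatedStack : ∀ {a m} → Occupied a (m - 1ℤ) ⊎ Occupied a (m + 1ℤ) → ¬ IsolatedStack a m
neighbour-¬isolatedStack (inj₁ occ) (_ , am-1≡0 , _) = occ am-1≡0
neighbour-¬isolatedStack (inj₂ occ) (_ , _ , am+1≡0) = occ am+1≡0

clusteron-occupied-neighbour : ∀ {C} → IsClusteron C → AtLeastTwoOccupied C →
                               ∀ {m} → Occupied C m → Occupied C (m - 1ℤ) ⊎ Occupied C (m + 1ℤ)
clusteron-occupied-neighbour {C} (l , r , _ , cluster) (p , q , p≢q , occ-p , occ-q) {m} occ-m =
  neighbour (l ≟ m) (m ≟ r)
  where
  bounds : ∀ {x} → Occupied C x → l ≤ x × x ≤ r
  bounds {x} = proj₁ (cluster x)
  inside : ∀ {x} → l ≤ x → x ≤ r → Occupied C x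
  inside {x} l≤x x≤r = proj₂ (cluster x) (l≤x , x≤r)
  l≤m : l ≤ m
  l≤m = proj₁ (bounds occ-m)
  m≤r : m ≤ r
  m≤r = proj₂ (bounds occ-m)
  pinned : l ≡ m → m ≡ r → ∀ {x} → Occupied C x → x ≡ m
  pinned l≡m m≡r {x} occ =
    ≤-antisym (subst (x ≤_) (sym m≡r) (proj₂ (bounds occ))) (subst (_≤ x) l≡m (proj₁ (bounds occ)))
  neighbour : Dec (l ≡ m) → Dec (m ≡ r) → Occupied C (m - 1ℤ) ⊎ Occupied C (m + 1ℤ)
  neighbour (no l≢m) _ =
    inj₁ (inside (i<j⇒i≤j-1 (≤∧≢⇒< l≤m l≢m)) (<⇒≤ (<-≤-trans (i-1<i m) m≤r)))
  neighbour (yes _) (no m≢r) =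
    inj₂ (inside (<⇒≤ (≤-<-trans l≤m (i<i+1 m))) (i<j⇒i+1≤j (≤∧≢⇒< m≤r m≢r)))
  neighbour (yes l≡m) (yes m≡r) =
    ⊥-elim (p≢q (trans (pinned l≡m m≡r occ-p) (sym (pinned l≡m m≡r occ-q))))

clusteron-noIsolatedStack : ∀ {C} → IsClusteron C → AtLeastTwoOccupied C → NoIsolatedStack C
clusteron-noIsolatedStack {C} cluster two m stack@(Cm≥2 , _) =
  neighbour-¬isolatedStack {C} {m} (clusteron-occupied-neighbour cluster two (ℕ.m<n⇒n≢0 Cm≥2)) stack

module _ {a : Config} {i j k : ℤ}
         (j<i : j < i) (aj≡0 : a j ≡ 0) (occ-left : ∀ m → j < m → m ≤ i → Occupied a m)
         (i+1<k : i + 1ℤ < k) (ak≡0 : a k ≡ 0) (occ-right : ∀ m → i + 1ℤ ≤ m → m < k → Occupied a m)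
         where

  private
    b : Config
    b = moveResult a i j k

    j<k : j < k
    j<k = <-trans j<i (<-trans (i<i+1 i) i+1<k)

    b[j]≡1 : b j ≡ 1
    b[j]≡1 = trans (moveResult-left a i j k (<⇒≢ j<i) (<⇒≢ (<-trans j<i (i<i+1 i))) (<⇒≢ j<k))
                   (cong suc aj≡0)

    b[k]≡1 : b k ≡ 1
    b[k]≡1 = trans (moveResult-right a i j k (>⇒≢ (<-trans (i<i+1 i) i+1<k)) (>⇒≢ i+1<k) (>⇒≢ j<k))
                   (cong suc ak≡0)

    unmoved : ∀ {x} → x < i ⊎ i + 1ℤ < x → a x ℕ.≤ b x
    unmoved (inj₁ x<i)   = moveResult-≥ a i j k (<⇒≢ x<i) (<⇒≢ (<-trans x<i (i<i+1 i)))
    unmoved (inj₂ i+1<x) = moveResult-≥ a i j k (>⇒≢ (<-trans (i<i+1 i) i+1<x)) (>⇒≢ i+1<x)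

    occupied-left : ∀ {x} → j ≤ x → x < i → Occupied b x
    occupied-left {x} j≤x x<i = by-cases (x ≟ j)
      where
      by-cases : Dec (x ≡ j) → Occupied b x
      by-cases (yes refl) = ℕ.n>0⇒n≢0 (ℕ.≤-reflexive (sym b[j]≡1))
      by-cases (no x≢j)   = occ-left x (≤∧≢⇒< j≤x (x≢j ∘ sym)) (<⇒≤ x<i) ∘ m≤n∧n≡0⇒m≡0 (unmoved (inj₁ x<i))

    occupied-right : ∀ {x} → i + 1ℤ < x → x ≤ k → Occupied b x
    occupied-right {x} i+1<x x≤k = by-cases (x ≟ k)
      where
      by-cases : Dec (x ≡ k) → Occupied b x
      by-cases (yes refl) = ℕ.n>0⇒n≢0 (ℕ.≤-reflexive (sym b[k]≡1))
      by-cases (no x≢k)   = occ-right x (<⇒≤ i+1<x) (≤∧≢⇒< x≤k x≢k) ∘ m≤n∧n≡0⇒m≡0 (unmoved (inj₂ i+1<x))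

    interior-occupied-neighbour : ∀ {m} → j < m → m < k → Occupied b (m - 1ℤ) ⊎ Occupied b (m + 1ℤ)
    interior-occupied-neighbour {m} j<m m<k with m ≤? i
    ... | yes m≤i = inj₁ (occupied-left (i<j⇒i≤j-1 j<m) (<-≤-trans (i-1<i m) m≤i))
    ... | no m≰i  = inj₂ (occupied-right (+-monoˡ-< 1ℤ (≰⇒> m≰i)) (i<j⇒i+1≤j m<k))

    exterior-stack : ∀ {m} → m ≢ j → m ≢ k →
                     m - 1ℤ < i ⊎ i + 1ℤ < m - 1ℤ → m + 1ℤ < i ⊎ i + 1ℤ < m + 1ℤ →
                     IsolatedStack b m → IsolatedStack a m
    exterior-stack m≢j m≢k m-1-unmoved m+1-unmoved (bm≥2 , bm-1≡0 , bm+1≡0) =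
      ℕ.≤-trans bm≥2 (moveResult-≤ a i j k m≢j m≢k) ,
      m≤n∧n≡0⇒m≡0 (unmoved m-1-unmoved) bm-1≡0 ,
      m≤n∧n≡0⇒m≡0 (unmoved m+1-unmoved) bm+1≡0

  moveResult-noIsolatedStack : NoIsolatedStack a → NoIsolatedStack b
  moveResult-noIsolatedStack none m stack with <-cmp m j | <-cmp m k
  ... | tri< m<j _ _  | _             = none m (exterior-stack (<⇒≢ m<j) (<⇒≢ (<-trans m<j j<k))
    (inj₁ (<-trans (i-1<i m) (<-trans m<j j<i))) (inj₁ (≤-<-trans (i<j⇒i+1≤j m<j) j<i)) stack)
  ... | tri≈ _ refl _ | _             = single-¬isolatedStack {b} {j} b[j]≡1 stack
  ... | tri> _ _ j<m  | tri< m<k _ _  = neighbour-¬isolatedStack {b} {m} (interior-occupied-neighbour j<m m<k) stack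
  ... | tri> _ _ _    | tri≈ _ refl _ = single-¬isolatedStack {b} {k} b[k]≡1 stack
  ... | tri> _ _ _    | tri> _ _ k<m  = none m (exterior-stack (>⇒≢ (<-trans j<k k<m)) (>⇒≢ k<m)
    (inj₂ (<-≤-trans i+1<k (i<j⇒i≤j-1 k<m))) (inj₂ (<-trans i+1<k (<-trans k<m (i<i+1 m)))) stack)

move-noIsolatedStack : ∀ {a b} → Move a b → NoIsolatedStack a → NoIsolatedStack b
move-noIsolatedStack (move _ _ _ _ _ j<i aj≡0 occ-left i+1<k ak≡0 occ-right) =
  moveResult-noIsolatedStack j<i aj≡0 occ-left i+1<k ak≡0 occ-right

reachable-noIsolatedStack : ∀ {a b} → Reachable a b → NoIsolatedStack a → NoIsolatedStack b
reachable-noIsolatedStack ε          = id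
reachable-noIsolatedStack (mv ◅ mvs) = reachable-noIsolatedStack mvs ∘ move-noIsolatedStack mv

proposition4p2 : (C : Config) → FiniteSupport C → IsClusteron C → AtLeastTwoOccupied C →
    ∀ b → Reachable C b → ∀ m → ¬ (b m ≥ 2 × b (m - 1ℤ) ≡ 0 × b (m + 1ℤ) ≡ 0)
proposition4p2 C _ cluster two b C⇒b = reachable-noIsolatedStack C⇒b (clusteron-noIsolatedStack cluster two)
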